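{- Let $q\ge5$ and $\mu\in\mathbb{F}_q\setminus\{0,1\}$. Let $R_{\mu,\gamma}=\mathrm{P}(\gamma,\mu,\gamma,1)$ for $\gamma\in\mathbb{F}_q$, $R_{\mu,\infty}=\mathrm{P}(1,0,1,0)$, and let $\ell_\mu=\{R_{\mu,\gamma}:\gamma\in\mathbb{F}_q\cup\{\infty\}\}$ be the line through $R_{\mu,0}$ and $R_{\mu,\infty}$. Then: (i) $\ell_\mu$ contains no point of the twisted cubic $\mathcal{C}$; (ii) $\ell_\mu$ is not a chord of $\mathcal{C}$; (iii) $\ell_\mu$ is contained in neither $\pi(\infty)$ nor $\pi(0)$; more precisely, $R_{\mu,\gamma}\notin\pi(\infty)$ for all $\gamma\in\mathbb{F}_q$, $R_{\mu,\infty}\notin\pi(0)$, and $R_{\mu,\infty}\in\pi(\infty)$; (iv) if $R_{\mu,\infty}\notin\pi(t)$ for all $t\in\mathbb{F}_q$, then $\ell_\mu$ is not contained in any osculating plane; (v) for $t\in\mathbb{F}_q$, $R_{\mu,\infty}\in\pi(t)$ if and only if $3t^2+1=0$.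
   Context: $\mathrm{P}(x_0,x_1,x_2,x_3)$ denotes a point of $\mathrm{PG}(3,q)$ in homogeneous coordinates. The twisted cubic is $\mathcal{C}=\{P(t): t\in\mathbb{F}_q\cup\{\infty\}\}$, $P(t)=\mathrm{P}(t^3,t^2,t,1)$ for $t\in\mathbb{F}_q$, $P(\infty)=\mathrm{P}(1,0,0,0)$; the same formula defines $P(t)$ for $t\in\mathbb{F}_{q^2}$. The osculating plane at $P(t)$ is $\pi(t): x_0-3tx_1+3t^2x_2-t^3x_3=0$ for $t\in\mathbb{F}_q$, and $\pi(\infty): x_3=0$. A chord of $\mathcal{C}$ is either a real chord (line joining two distinct points of $\mathcal{C}$), a tangent line (for $t\in\mathbb{F}_q$ the line through $P(t)$ and $\mathrm{P}(3t^2,2t,1,0)$; for $t=\infty$ the line through $\mathrm{P}(1,0,0,0)$ and $\mathrm{P}(0,1,0,0)$), or an imaginary chord (the line joining $P(t)$ and $P(t^q)$ for some $t\in\mathbb{F}_{q^2}\setminus\mathbb{F}_q$). -}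

module Defs where

open import Level using (0ℓ)
open import Data.Nat using (ℕ; zero; suc)
import Data.Nat
import Data.Sum
open import Data.Fin using (Fin)
open import Data.Maybe using (Maybe; just; nothing)
open import Data.Vec using (Vec; []; _∷_; map; zipWith)
open import Data.Product using (Σ; ∃; _×_; _,_)
open import Relation.Nullary using (¬_)
open import Relation.Binary.PropositionalEquality using (_≡_)
open import Algebra.Structures using (IsCommutativeRing)
open import Function.Bundles using (_↔_)

record FiniteField (q : ℕ) : Set₁ where
  infixl 6 _+_
  infixl 7 _*_
  field
    Carrier : Set
    _+_ _*_ : Carrier → Carrier → Carrier
    -_      : Carrier → Carrier
    0# 1#   : Carrier
    isCommutativeRing : IsCommutativeRing _≡_ _+_ _*_ -_ 0# 1#
    0≢1     : ¬ (0# ≡ 1#)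
    inverse : ∀ x → ¬ (x ≡ 0#) → ∃ λ y → x * y ≡ 1#
    enum    : Carrier ↔ Fin q

  _^_ : Carrier → ℕ → Carrier
  x ^ zero  = 1#
  x ^ suc n = x * (x ^ n)

  2# 3# : Carrier
  2# = 1# + 1#
  3# = 2# + 1#

-- Projective 3-space PG(3,F) over a field F: points are nonzero vectors
-- of F^4 up to nonzero scalars.

module Geometry {q : ℕ} (F : FiniteField q) where
  open FiniteField F

  V4 : Set
  V4 = Vec Carrier 4

  vec : Carrier → Carrier → Carrier → Carrier → V4
  vec a b c d = a ∷ b ∷ c ∷ d ∷ []

  zero4 : V4
  zero4 = vec 0# 0# 0# 0#

  _•_ : Carrier → V4 → V4
  c • v = map (c *_) v

  _⊕_ : V4 → V4 → V4
  _⊕_ = zipWith _+_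

  NonZero4 : V4 → Set
  NonZero4 v = ¬ (v ≡ zero4)

  SamePoint : V4 → V4 → Set
  SamePoint X Y = ∃ λ c → ¬ (c ≡ 0#) × (X ≡ c • Y)

  InSpan : V4 → V4 → V4 → Set
  InSpan A B X = ∃ λ a → ∃ λ b → X ≡ (a • A) ⊕ (b • B)

  -- Points of the twisted cubic: P(t), with nothing standing for ∞.
  P : Maybe Carrier → V4
  P (just t) = vec (t ^ 3) (t ^ 2) t 1#
  P nothing  = vec 1# 0# 0# 0#

  -- Second spanning vector of the tangent line at P(t).
  Tdir : Maybe Carrier → V4
  Tdir (just t) = vec (3# * (t ^ 2)) (2# * t) 1# 0#
  Tdir nothing  = vec 0# 1# 0# 0#

  OnPlane : V4 → V4 → Set
  OnPlane (a0 ∷ a1 ∷ a2 ∷ a3 ∷ []) (x0 ∷ x1 ∷ x2 ∷ x3 ∷ []) =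
    a0 * x0 + a1 * x1 + a2 * x2 + a3 * x3 ≡ 0#

  π : Maybe Carrier → V4
  π (just t) = vec 1# (- (3# * t)) (3# * (t ^ 2)) (- (t ^ 3))
  π nothing  = vec 0# 0# 0# 1#

-- A quadratic extension F_{q^2} of a field F_q: a field with q*q elements
-- together with a ring homomorphism (hence an embedding) F_q → F_{q^2}.

record QuadExt {q : ℕ} (K : FiniteField q) : Set₁ where
  open FiniteField K using () renaming
    (Carrier to K₀; _+_ to _+K_; _*_ to _*K_; 1# to 1K)
  field
    L : FiniteField (q Data.Nat.* q)
  open FiniteField L using () renaming
    (Carrier to L₀; _+_ to _+L_; _*_ to _*L_; 1# to 1L)
  field
    ι   : K₀ → L₀
    ι-+ : ∀ x y → ι (x +K y) ≡ ι x +L ι y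
    ι-* : ∀ x y → ι (x *K y) ≡ ι x *L ι y
    ι-1 : ι 1K ≡ 1L

-- Chords of the twisted cubic of PG(3,q), as sets of points of PG(3,q)
-- (predicates on representative vectors).

module Chords {q : ℕ} (K : FiniteField q) (E : QuadExt K) where
  open FiniteField K
  open Geometry K
  open QuadExt E
  module LF = FiniteField L
  module LG = Geometry L

  RealChordPts : Maybe Carrier → Maybe Carrier → V4 → Set
  RealChordPts a b X = NonZero4 X × InSpan (P a) (P b) X

  TangentPts : Maybe Carrier → V4 → Set
  TangentPts t X = NonZero4 X × InSpan (P t) (Tdir t) X

  -- the imaginary chord P(τ)P(τ^q), τ ∈ F_{q^2} \ F_q : its F_q-rational points
  ImagChordPts : LF.Carrier → V4 → Set
  ImagChordPts τ X =
    NonZero4 X × LG.InSpan (LG.P (just τ)) (LG.P (just (τ LF.^ q))) (map ι X)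

  NotInBase : LF.Carrier → Set
  NotInBase τ = ¬ (∃ λ x → ι x ≡ τ)

  SameSet : (V4 → Set) → (V4 → Set) → Set
  SameSet S T = ∀ X → NonZero4 X → (S X → T X) × (T X → S X)

  IsChord : (V4 → Set) → Set
  IsChord S =
      (∃ λ a → ∃ λ b → ¬ (a ≡ b) × SameSet S (RealChordPts a b))
    Data.Sum.⊎ ((∃ λ t → SameSet S (TangentPts t))
    Data.Sum.⊎ (∃ λ τ → NotInBase τ × SameSet S (ImagChordPts τ)))

module LineMu {q : ℕ} (K : FiniteField q) (μ : FiniteField.Carrier K) where
  open FiniteField K
  open Geometry K

  R : Maybe Carrier → V4
  R (just γ) = vec γ μ γ 1#
  R nothing  = vec 1# 0# 1# 0#

  ℓPts : V4 → Set
  ℓPts X = ∃ λ γ → SamePoint X (R γ)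

{-# OPTIONS --safe #-}
module Submission where

open import Defs
open import Data.Nat using (ℕ; _≤_)
open import Data.Maybe using (Maybe; just; nothing)
open import Data.Product using (_×_; _,_; proj₁; proj₂)
open import Data.Sum using (inj₁; inj₂)
open import Data.Vec using (Vec; []; _∷_; map; zipWith)
open import Data.Vec.Properties using (map-cong; map-id)
open import Function.Bundles using (_⇔_; mk⇔; Equivalence)
open import Relation.Nullary using (¬_)
open import Relation.Binary.PropositionalEquality
  using (_≡_; _≢_; refl; sym; trans; cong; cong₂; subst; module ≡-Reasoning)
open import Algebra.Bundles using (CommutativeRing)
import Algebra.Properties.Ring as RingProperties
import Algebra.Solver.Ring.NaturalCoefficients.Default as NaturalCoefficientSolver

-- The line ℓ_μ is spanned by R_{μ,∞} = (1,0,1,0) and R_{μ,0} = (0,μ,0,1).  A point P(t) on it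
-- would satisfy t³ = t and t² = μ, hence t(μ − 1) = 0, so t = 0 and μ = 0.  Real chords and
-- tangents pass through a point of 𝒞, so they are not ℓ_μ.  Every vector x = a P(τ) + b P(σ)
-- satisfies x₀ + τσ x₂ = (τ + σ) x₁ and x₁ + τσ x₃ = (τ + σ) x₂; if the line P(τ)P(σ) over
-- F_{q²} contained both spanning vectors of ℓ_μ, these would give τσ = −1 and τσ = −μ, so μ = 1.
-- The statements about osculating planes are direct evaluations.

vec-injective : ∀ {A : Set} {a b c d a′ b′ c′ d′ : A} →
                (a ∷ b ∷ c ∷ d ∷ []) ≡ (a′ ∷ b′ ∷ c′ ∷ d′ ∷ []) →
                a ≡ a′ × b ≡ b′ × c ≡ c′ × d ≡ d′
vec-injective refl = refl , refl , refl , refl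

module FieldProperties {q : ℕ} (F : FiniteField q) where
  open FiniteField F

  commutativeRing : CommutativeRing _ _
  commutativeRing = record { isCommutativeRing = isCommutativeRing }

  open CommutativeRing commutativeRing public
    using (+-identityʳ; *-identityˡ; *-identityʳ; *-assoc; zeroˡ; zeroʳ; -‿inverseʳ)
  open RingProperties (CommutativeRing.ring commutativeRing) public
    using (+-cancelʳ; x∙y⁻¹≈ε⇒x≈y; x+x≈x⇒x≈0; x[y-z]≈xy-xz)
  open NaturalCoefficientSolver (CommutativeRing.commutativeSemiring commutativeRing) public
    using (solve; _:=_; _:+_; _:*_; con)

  1≢0 : 1# ≢ 0#
  1≢0 1≡0 = 0≢1 (sym 1≡0)

  x*y≡0∧y≢0⇒x≡0 : ∀ {x y} → x * y ≡ 0# → y ≢ 0# → x ≡ 0#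
  x*y≡0∧y≢0⇒x≡0 {x} {y} xy≡0 y≢0 with inverse y y≢0
  ... | z , yz≡1 = begin
    x            ≡⟨ sym (*-identityʳ x) ⟩
    x * 1#       ≡⟨ cong (x *_) (sym yz≡1) ⟩
    x * (y * z)  ≡⟨ sym (*-assoc x y z) ⟩
    x * y * z    ≡⟨ cong (_* z) xy≡0 ⟩
    0# * z       ≡⟨ zeroˡ z ⟩
    0#           ∎
    where open ≡-Reasoning

  x*y≡x∧y≢1⇒x≡0 : ∀ {x y} → x * y ≡ x → y ≢ 1# → x ≡ 0#
  x*y≡x∧y≢1⇒x≡0 {x} {y} xy≡x y≢1 =
    x*y≡0∧y≢0⇒x≡0 x[y-1]≡0 (λ y-1≡0 → y≢1 (x∙y⁻¹≈ε⇒x≈y y 1# y-1≡0))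
    where
    open ≡-Reasoning
    x[y-1]≡0 : x * (y + - 1#) ≡ 0#
    x[y-1]≡0 = begin
      x * (y + - 1#)      ≡⟨ x[y-z]≈xy-xz x y 1# ⟩
      x * y + - (x * 1#)  ≡⟨ cong₂ (λ u v → u + - v) xy≡x (*-identityʳ x) ⟩
      x + - x             ≡⟨ -‿inverseʳ x ⟩
      0#                  ∎

module GeometryProperties {q : ℕ} (F : FiniteField q) where
  open FiniteField F
  open Geometry F
  open FieldProperties F

  •-identityˡ : ∀ {n} (v : Vec Carrier n) → map (1# *_) v ≡ v
  •-identityˡ v = trans (map-cong *-identityˡ v) (map-id v)

  P-nonzero : ∀ t → NonZero4 (P t)
  P-nonzero (just t) P≡0 = 1≢0 (proj₂ (proj₂ (proj₂ (vec-injective P≡0))))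
  P-nonzero nothing  P≡0 = 1≢0 (proj₁ (vec-injective P≡0))

  span-left : ∀ {n} (A B : Vec Carrier n) →
              A ≡ zipWith _+_ (map (1# *_) A) (map (0# *_) B)
  span-left []      []      = refl
  span-left (a ∷ A) (b ∷ B) = cong₂ _∷_ a≡1a+0b (span-left A B)
    where
    a≡1a+0b : a ≡ 1# * a + 0# * b
    a≡1a+0b = sym (trans (cong₂ _+_ (*-identityˡ a) (zeroˡ b)) (+-identityʳ a))

  secant-relations : ∀ τ σ {x₀ x₁ x₂ x₃} →
                     InSpan (P (just τ)) (P (just σ)) (vec x₀ x₁ x₂ x₃) →
                     x₀ + τ * σ * x₂ ≡ (τ + σ) * x₁ × x₁ + τ * σ * x₃ ≡ (τ + σ) * x₂
  secant-relations τ σ (a , b , x≡aPτ+bPσ) with vec-injective x≡aPτ+bPσ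
  ... | refl , refl , refl , refl = relation₀ a b τ σ , relation₁ a b τ σ
    where
    relation₀ : ∀ a b τ σ →
      a * τ ^ 3 + b * σ ^ 3 + τ * σ * (a * τ + b * σ) ≡ (τ + σ) * (a * τ ^ 2 + b * σ ^ 2)
    relation₀ = solve 4 (λ a b τ σ →
        a :* (τ :* (τ :* (τ :* con 1))) :+ b :* (σ :* (σ :* (σ :* con 1)))
          :+ τ :* σ :* (a :* τ :+ b :* σ)
      := (τ :+ σ) :* (a :* (τ :* (τ :* con 1)) :+ b :* (σ :* (σ :* con 1)))) refl
    relation₁ : ∀ a b τ σ →
      a * τ ^ 2 + b * σ ^ 2 + τ * σ * (a * 1# + b * 1#) ≡ (τ + σ) * (a * τ + b * σ)
    relation₁ = solve 4 (λ a b τ σ →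
        a :* (τ :* (τ :* con 1)) :+ b :* (σ :* (σ :* con 1)) :+ τ :* σ :* (a :* con 1 :+ b :* con 1)
      := (τ :+ σ) :* (a :* τ :+ b :* σ)) refl

  secant∋1010∧0m01⇒m≡1 : ∀ τ σ {m} →
                          InSpan (P (just τ)) (P (just σ)) (vec 1# 0# 1# 0#) →
                          InSpan (P (just τ)) (P (just σ)) (vec 0# m 0# 1#) →
                          m ≡ 1#
  secant∋1010∧0m01⇒m≡1 τ σ {m} span₁ span₂ =
    +-cancelʳ (τ * σ * 1#) m 1# (trans m-relation (sym 1-relation))
    where
    1-relation : 1# + τ * σ * 1# ≡ (τ + σ) * 0#
    1-relation = proj₁ (secant-relations τ σ span₁)
    m-relation : m + τ * σ * 1# ≡ (τ + σ) * 0#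
    m-relation = proj₂ (secant-relations τ σ span₂)

module EmbeddingProperties {q : ℕ} {K : FiniteField q} (E : QuadExt K) where
  open QuadExt E
  module K = FiniteField K
  module L = FiniteField L
  module KP = FieldProperties K
  module LP = FieldProperties L

  ι-0 : ι K.0# ≡ L.0#
  ι-0 = LP.x+x≈x⇒x≈0 (ι K.0#) (trans (sym (ι-+ K.0# K.0#)) (cong ι (KP.+-identityʳ K.0#)))

  ι-≢ : ∀ {x y} → x ≢ y → ι x ≢ ι y
  ι-≢ {x} {y} x≢y ιx≡ιy with K.inverse (x K.+ K.- y) (λ x-y≡0 → x≢y (KP.x∙y⁻¹≈ε⇒x≈y x y x-y≡0))
  ... | z , [x-y]z≡1 = LP.1≢0 (begin
    L.1#                          ≡⟨ sym ι-1 ⟩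
    ι K.1#                        ≡⟨ cong ι (sym [x-y]z≡1) ⟩
    ι ((x K.+ K.- y) K.* z)       ≡⟨ ι-* (x K.+ K.- y) z ⟩
    ι (x K.+ K.- y) L.* ι z       ≡⟨ cong (L._* ι z) ι[x-y]≡0 ⟩
    L.0# L.* ι z                  ≡⟨ LP.zeroˡ (ι z) ⟩
    L.0#                          ∎)
    where
    open ≡-Reasoning
    ι[x-y]≡0 : ι (x K.+ K.- y) ≡ L.0#
    ι[x-y]≡0 = begin
      ι (x K.+ K.- y)       ≡⟨ ι-+ x (K.- y) ⟩
      ι x L.+ ι (K.- y)     ≡⟨ cong (L._+ ι (K.- y)) ιx≡ιy ⟩
      ι y L.+ ι (K.- y)     ≡⟨ sym (ι-+ y (K.- y)) ⟩
      ι (y K.+ K.- y)       ≡⟨ cong ι (KP.-‿inverseʳ y) ⟩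
      ι K.0#                ≡⟨ ι-0 ⟩
      L.0#                  ∎

module LineProperties {q : ℕ} (K : FiniteField q) (μ : FiniteField.Carrier K) where
  open FiniteField K
  open Geometry K
  open LineMu K μ
  open FieldProperties K
  open GeometryProperties K

  pairing : V4 → V4 → Carrier
  pairing (a₀ ∷ a₁ ∷ a₂ ∷ a₃ ∷ []) (x₀ ∷ x₁ ∷ x₂ ∷ x₃ ∷ []) = a₀ * x₀ + a₁ * x₁ + a₂ * x₂ + a₃ * x₃

  R-nonzero : ∀ γ → NonZero4 (R γ)
  R-nonzero (just γ) R≡0 = 1≢0 (proj₂ (proj₂ (proj₂ (vec-injective R≡0))))
  R-nonzero nothing  R≡0 = 1≢0 (proj₁ (vec-injective R≡0))

  R∈ℓ : ∀ γ → ℓPts (R γ)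
  R∈ℓ γ = γ , 1# , 1≢0 , sym (•-identityˡ (R γ))

  π∞-at-R : ∀ γ → pairing (π nothing) (R (just γ)) ≡ 1#
  π∞-at-R γ = solve 2 (λ γ μ → con 0 :* γ :+ con 0 :* μ :+ con 0 :* γ :+ con 1 :* con 1 := con 1)
                refl γ μ

  π-at-R∞ : ∀ t → pairing (π (just t)) (R nothing) ≡ 3# * t ^ 2 + 1#
  π-at-R∞ t = solve 3 (λ u n m → con 1 :* con 1 :+ n :* con 0 :+ u :* con 1 :+ m :* con 0
                                := u :+ con 1)
                refl (3# * t ^ 2) (- (3# * t)) (- (t ^ 3))

  R∉π∞ : ∀ γ → ¬ OnPlane (π nothing) (R (just γ))
  R∉π∞ γ R∈π∞ = 1≢0 (trans (sym (π∞-at-R γ)) R∈π∞)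

  R∞∈π∞ : OnPlane (π nothing) (R nothing)
  R∞∈π∞ = solve 0 (con 0 :* con 1 :+ con 0 :* con 0 :+ con 0 :* con 1 :+ con 1 :* con 0
                     := con 0) refl

  R∞∈π⇔ : ∀ t → OnPlane (π (just t)) (R nothing) ⇔ (3# * t ^ 2 + 1# ≡ 0#)
  R∞∈π⇔ t = mk⇔ (trans (sym (π-at-R∞ t))) (trans (π-at-R∞ t))

  R∞∉π₀ : ¬ OnPlane (π (just 0#)) (R nothing)
  R∞∉π₀ R∞∈π₀ = 1≢0 (trans (sym (k*0²+1≡1 3#)) (Equivalence.to (R∞∈π⇔ 0#) R∞∈π₀))
    where
    k*0²+1≡1 : ∀ k → k * 0# ^ 2 + 1# ≡ 1#
    k*0²+1≡1 = solve 1 (λ k → k :* (con 0 :* (con 0 :* con 1)) :+ con 1 := con 1) refl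

  ℓ⊄π : (∀ t → ¬ OnPlane (π (just t)) (R nothing)) → ∀ t → ¬ (∀ γ → OnPlane (π t) (R γ))
  ℓ⊄π R∞∉π (just t) ℓ⊆π = R∞∉π t (ℓ⊆π nothing)
  ℓ⊄π R∞∉π nothing  ℓ⊆π = R∉π∞ 0# (ℓ⊆π (just 0#))

  module _ (μ≢0 : μ ≢ 0#) (μ≢1 : μ ≢ 1#) where

    P∉ℓ : ∀ t → ¬ ℓPts (P t)
    P∉ℓ (just t) (just γ  , c , _   , Pt≡cR) with vec-injective Pt≡cR
    ... | t³≡cγ , t²≡cμ , t≡cγ , 1≡c1 = μ≢0 (begin
      μ          ≡⟨ sym t²≡μ ⟩
      t ^ 2      ≡⟨ cong (_^ 2) t≡0 ⟩
      0# ^ 2     ≡⟨ zeroˡ (0# * 1#) ⟩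
      0#         ∎)
      where
      open ≡-Reasoning
      c≡1 : c ≡ 1#
      c≡1 = trans (sym (*-identityʳ c)) (sym 1≡c1)
      t²≡μ : t ^ 2 ≡ μ
      t²≡μ = trans t²≡cμ (trans (cong (_* μ) c≡1) (*-identityˡ μ))
      tμ≡t : t * μ ≡ t
      tμ≡t = trans (cong (t *_) (sym t²≡μ)) (trans t³≡cγ (sym t≡cγ))
      t≡0 : t ≡ 0#
      t≡0 = x*y≡x∧y≢1⇒x≡0 tμ≡t μ≢1
    P∉ℓ (just t) (nothing , c , _   , Pt≡cR∞) with vec-injective Pt≡cR∞
    ... | _ , _ , _ , 1≡c0 = 1≢0 (trans 1≡c0 (zeroʳ c))
    P∉ℓ nothing  (just γ  , c , c≢0 , P∞≡cR)  with vec-injective P∞≡cR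
    ... | _ , _ , _ , 0≡c1 = c≢0 (trans (sym (*-identityʳ c)) (sym 0≡c1))
    P∉ℓ nothing  (nothing , c , c≢0 , P∞≡cR∞) with vec-injective P∞≡cR∞
    ... | _ , _ , 0≡c1 , _ = c≢0 (trans (sym (*-identityʳ c)) (sym 0≡c1))

    module _ (E : QuadExt K) where
      open Chords K E
      open QuadExt E using (L; ι; ι-1)
      open EmbeddingProperties E using (ι-0; ι-≢)

      ι-R∞ : map ι (R nothing) ≡ LG.vec LF.1# LF.0# LF.1# LF.0#
      ι-R∞ rewrite ι-1 | ι-0 = refl

      ι-R₀ : map ι (R (just 0#)) ≡ LG.vec LF.0# (ι μ) LF.0# LF.1#
      ι-R₀ rewrite ι-1 | ι-0 = refl

      ℓ≉line-through-P : ∀ a B → ¬ SameSet ℓPts (λ X → NonZero4 X × InSpan (P a) B X)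
      ℓ≉line-through-P a B ℓ≈aB =
        P∉ℓ a (proj₂ (ℓ≈aB (P a) (P-nonzero a)) (P-nonzero a , 1# , 0# , span-left (P a) B))

      ℓ-not-chord : ¬ IsChord ℓPts
      ℓ-not-chord (inj₁ (a , b , _ , ℓ≈ab))       = ℓ≉line-through-P a (P b) ℓ≈ab
      ℓ-not-chord (inj₂ (inj₁ (t , ℓ≈tangent)))   = ℓ≉line-through-P t (Tdir t) ℓ≈tangent
      ℓ-not-chord (inj₂ (inj₂ (τ , _ , ℓ≈imaginary))) =
        ι-≢ μ≢1 (trans ιμ≡1 (sym ι-1))
        where
        imaginary-span : ∀ γ → LG.InSpan (LG.P (just τ)) (LG.P (just (τ LF.^ q))) (map ι (R γ))
        imaginary-span γ = proj₂ (proj₁ (ℓ≈imaginary (R γ) (R-nonzero γ)) (R∈ℓ γ))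
        ιμ≡1 : ι μ ≡ LF.1#
        ιμ≡1 = GeometryProperties.secant∋1010∧0m01⇒m≡1 L τ (τ LF.^ q)
                 (subst (LG.InSpan _ _) ι-R∞ (imaginary-span nothing))
                 (subst (LG.InSpan _ _) ι-R₀ (imaginary-span (just 0#)))

lemma4p2 : (q : ℕ) → 5 ≤ q → (K : FiniteField q) → (E : QuadExt K) →
    (μ : FiniteField.Carrier K) →
    ¬ (μ ≡ FiniteField.0# K) → ¬ (μ ≡ FiniteField.1# K) →
    let open FiniteField K
        open Geometry K
        open Chords K E
        open LineMu K μ
    in
    -- (i) ℓ_μ contains no point of the twisted cubic
    (∀ (t : Maybe Carrier) → ¬ ℓPts (P t))
    -- (ii) ℓ_μ is not a chord
    × ¬ IsChord ℓPts
    -- (iii)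
    × ((¬ (∀ γ → OnPlane (π nothing) (R γ)))
       × (¬ (∀ γ → OnPlane (π (just 0#)) (R γ)))
       × (∀ (γ : Carrier) → ¬ OnPlane (π nothing) (R (just γ)))
       × ¬ OnPlane (π (just 0#)) (R nothing)
       × OnPlane (π nothing) (R nothing))
    -- (iv)
    × ((∀ (t : Carrier) → ¬ OnPlane (π (just t)) (R nothing)) →
       ∀ (t : Maybe Carrier) → ¬ (∀ γ → OnPlane (π t) (R γ)))
    -- (v)
    × (∀ (t : Carrier) →
         (OnPlane (π (just t)) (R nothing) → 3# * (t ^ 2) + 1# ≡ 0#)
         × (3# * (t ^ 2) + 1# ≡ 0# → OnPlane (π (just t)) (R nothing)))
lemma4p2 q _ K E μ μ≢0 μ≢1 =
    P∉ℓ μ≢0 μ≢1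
  , ℓ-not-chord μ≢0 μ≢1 E
  , ( (λ ℓ⊆π∞ → R∉π∞ 0# (ℓ⊆π∞ (just 0#)))
    , (λ ℓ⊆π₀ → R∞∉π₀ (ℓ⊆π₀ nothing))
    , R∉π∞
    , R∞∉π₀
    , R∞∈π∞ )
  , ℓ⊄π
  , λ t → Equivalence.to (R∞∈π⇔ t) , Equivalence.from (R∞∈π⇔ t)
  where
  open FiniteField K using (0#)
  open LineProperties K μ
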